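{- Let $k\ge 2$ be even and let $E$ be the equation $x_1+\cdots+x_{k/2}=x_{k/2+1}+\cdots+x_k$. Then for every $n\in\mathbb{N}$ and every coloring $f:[n]\to\{ -1,1\}$, the number of monochromatic solutions of $E$ in $[n]^k$ is at least $2^{1-k}$ times the total number of solutions of $E$ in $[n]^k$. In particular $\mu_E([n])\ge 2^{1-k}$ for all $n$, so $E$ is common over $[n]$.
   Context: $[n]=\{1,\dots,n\}$. A solution is a vector $(x_1,\dots,x_k)\in[n]^k$ satisfying the equation; it is monochromatic under $f$ if $f(x_1)=\cdots=f(x_k)$. $\mu_E([n])$ is the minimum over all colorings $f:[n]\to\{ -1,1\}$ of the number of monochromatic solutions divided by the total number of solutions in $[n]^k$. -}

module Defs where

open import Data.Nat using (ℕ; zero; suc; _+_; _*_; _≡ᵇ_)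
open import Data.Bool using (Bool; true; false; _∧_)
open import Data.Fin using (Fin; toℕ)
open import Data.List using (List; []; _∷_; map; concatMap; length; filterᵇ; allFin)
open import Data.Vec using (Vec; []; _∷_; take; drop; foldr)
open import Relation.Nullary.Decidable using (⌊_⌋)
open import Data.Bool.Properties using () renaming (_≟_ to _≟ᵇ_)
open import Relation.Binary.PropositionalEquality using (_≡_)

-- The interval [n] = {1,…,n} is represented by Fin n, element i ↦ toℕ i + 1.
val : {n : ℕ} → Fin n → ℕ
val i = suc (toℕ i)

vsum : {n j : ℕ} → Vec (Fin n) j → ℕ
vsum = foldr _ (λ x s → val x + s) 0

allVecs : (n j : ℕ) → List (Vec (Fin n) j)
allVecs n zero = []  ∷ []
allVecs n (suc j) = concatMap (λ x → map (x ∷_) (allVecs n j)) (allFin n)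

isSolution : {n : ℕ} (m : ℕ) → Vec (Fin n) (m + m) → Bool
isSolution m x = vsum (take m x) ≡ᵇ vsum (drop m x)

-- a coloring f : [n] → {-1,1} is modelled as f : Fin n → Bool
vecAll : {A : Set} {j : ℕ} → (A → Bool) → Vec A j → Bool
vecAll p = foldr _ (λ a b → p a ∧ b) true

isMono : {n j : ℕ} → (Fin n → Bool) → Vec (Fin n) j → Bool
isMono {n} f [] = true
isMono {n} f (x ∷ xs) = vecAll (λ y → ⌊ f y ≟ᵇ f x ⌋) xs

numSolutions : (n m : ℕ) → ℕ
numSolutions n m = length (filterᵇ (isSolution m) (allVecs n (m + m)))

numMonoSolutions : (n m : ℕ) → (Fin n → Bool) → ℕ
numMonoSolutions n m f =
  length (filterᵇ (λ x → isSolution m x ∧ isMono f x) (allVecs n (m + m)))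

-- Weight each x ∈ [n] by the indicators a, b of the two colour classes, and let r_W(s) be the
-- weighted number of vectors in [n]^m with coordinate sum s and weights W = (w₁,…,w_m). The number
-- of solutions is the energy Σ_s r_W(s)² of W = (a+b,…,a+b); the number of monochromatic ones is
-- the energy of (a,…,a) plus that of (b,…,b). This is the discrete form of the convexity bound
-- ∫|â + b̂|^{2m} ≤ 2^{2m-1} (∫|â|^{2m} + ∫|b̂|^{2m}), and it is proved with two tools:
--   * Cauchy–Schwarz, 2 Σ_s r_X r_Y ≤ Σ_s r_X² + Σ_s r_Y²;
--   * reflecting a variable x ↦ n+1-x moves it to the other side of the equation.
-- Energy is linear in each weight, so Cauchy–Schwarz bounds the energy of (a+b) ∷ W by twice the
-- sum of those of a ∷ W and b ∷ W; iterating, E(a+b,…,a+b) is at most 2^m times the sum of the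
-- energies of the 2^m words in a and b. Reflection followed by Cauchy–Schwarz shows that the
-- energies of the words with i letters a form a convex sequence in i, so their sum is at most
-- 2^{m-1} (E(a,…,a) + E(b,…,b)).
module Submission where

open import Defs
open import Data.Nat using (ℕ; suc; _+_; _*_; _^_; _≤_)
open import Data.Fin using (Fin)
open import Data.Bool using (Bool)

open import Data.Nat using (zero; _<_; _∸_; _≟_; z≤n; s≤s)
open import Data.Nat.Properties
open import Data.Nat.ListAction using () renaming (sum to sumˡ)
open import Data.Nat.ListAction.Properties using () renaming (sum-++ to sumˡ-++)
open import Data.Nat.Tactic.RingSolver using (solve-∀)
open import Data.Bool using (true; false; _∧_; if_then_else_)
open import Data.Bool.Properties using () renaming (_≟_ to _≟ᵇ_)
open import Data.Fin using (zero; suc; toℕ; opposite; fromℕ<; punchIn)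
open import Data.Fin.Properties using (toℕ<n; toℕ-fromℕ<; toℕ-injective; punchInᵢ≢i; opposite-prop)
open import Data.Fin.Permutation using (reverse)
open import Data.List using (List; []; _∷_; _++_; map; replicate; length; filterᵇ; concatMap; tabulate)
open import Data.List.Properties using (map-++; map-∘; ++-identityʳ)
open import Data.List.Relation.Binary.Permutation.Propositional as ↭ using (_↭_; ↭-sym)
open import Data.List.Relation.Binary.Permutation.Propositional.Properties using (shift)
open import Data.Vec using (Vec; []; _∷_; take; drop)
open import Data.Sum using ([_,_]′)
open import Data.Product using (_,_)
open import Function using (id; _∘_)
open import Relation.Nullary using (yes; no)
open import Relation.Nullary.Decidable using (does; dec-true; dec-false; ⌊_⌋)
open import Relation.Binary.PropositionalEquality
  using (_≡_; _≢_; refl; sym; trans; cong; cong₂; subst; subst₂; module ≡-Reasoning)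
open import Algebra.Properties.Semiring.Sum +-*-semiring
  using (sum-syntax; sum-cong-≗; sum-remove; sum-replicate-zero; ∑-distrib-+; ∑-comm; ∑-permute;
         *-distribˡ-sum)
open import Algebra.Properties.CommutativeSemigroup *-commutativeSemigroup using (x∙yz≈y∙xz)

𝟙 : Bool → ℕ
𝟙 b = if b then 1 else 0

𝟙-∧ : ∀ s t → 𝟙 (s ∧ t) ≡ 𝟙 s * 𝟙 t
𝟙-∧ true  t = sym (+-identityʳ (𝟙 t))
𝟙-∧ false t = refl

δ : ℕ → ℕ → ℕ
δ s t = 𝟙 (does (s ≟ t))

δ-≡ : ∀ {s t} → s ≡ t → δ s t ≡ 1
δ-≡ {s} {t} s≡t rewrite dec-true (s ≟ t) s≡t = refl

δ-≢ : ∀ {s t} → s ≢ t → δ s t ≡ 0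
δ-≢ {s} {t} s≢t rewrite dec-false (s ≟ t) s≢t = refl

δ-cong : ∀ {s t s′ t′} → (s ≡ t → s′ ≡ t′) → (s′ ≡ t′ → s ≡ t) → δ s t ≡ δ s′ t′
δ-cong {s} {t} to from with s ≟ t
... | yes s≡t = trans (δ-≡ s≡t) (sym (δ-≡ (to s≡t)))
... | no  s≢t = trans (δ-≢ s≢t) (sym (δ-≢ (s≢t ∘ from)))

length-filterᵇ : ∀ {A : Set} (p : A → Bool) xs → length (filterᵇ p xs) ≡ sumˡ (map (𝟙 ∘ p) xs)
length-filterᵇ p []       = refl
length-filterᵇ p (x ∷ xs) with p x
... | true  = cong suc (length-filterᵇ p xs)
... | false = length-filterᵇ p xs

sumˡ-concatMap-tabulate : ∀ {A B : Set} {m} (t : Fin m → A) (h : A → List B) (F : B → ℕ) →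
  sumˡ (map F (concatMap h (tabulate t))) ≡ ∑[ i < m ] sumˡ (map F (h (t i)))
sumˡ-concatMap-tabulate {m = zero}  t h F = refl
sumˡ-concatMap-tabulate {m = suc m} t h F = begin
  sumˡ (map F (h (t zero) ++ rest))                      ≡⟨ cong sumˡ (map-++ F (h (t zero)) rest) ⟩
  sumˡ (map F (h (t zero)) ++ map F rest)                ≡⟨ sumˡ-++ (map F (h (t zero))) (map F rest) ⟩
  sumˡ (map F (h (t zero))) + sumˡ (map F rest)          ≡⟨ cong (sumˡ (map F (h (t zero))) +_)
                                                              (sumˡ-concatMap-tabulate (t ∘ suc) h F) ⟩
  ∑[ i < suc m ] sumˡ (map F (h (t i)))                  ∎
  where
  open ≡-Reasoning
  rest = concatMap h (tabulate (t ∘ suc))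

∑-mono-≤ : ∀ {m} {f g : Fin m → ℕ} → (∀ i → f i ≤ g i) → ∑[ i < m ] f i ≤ ∑[ i < m ] g i
∑-mono-≤ {zero}  f≤g = z≤n
∑-mono-≤ {suc m} f≤g = +-mono-≤ (f≤g zero) (∑-mono-≤ (f≤g ∘ suc))

∑-*-comm : ∀ {m k} (u : Fin m → ℕ) (v : Fin k → ℕ) (h : Fin m → Fin k → ℕ) →
  ∑[ x < m ] (u x * ∑[ y < k ] (v y * h x y)) ≡ ∑[ y < k ] (v y * ∑[ x < m ] (u x * h x y))
∑-*-comm {m} {k} u v h = begin
  ∑[ x < m ] (u x * ∑[ y < k ] (v y * h x y))
    ≡⟨ sum-cong-≗ (λ x → *-distribˡ-sum (u x) (λ y → v y * h x y)) ⟩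
  ∑[ x < m ] ∑[ y < k ] (u x * (v y * h x y))
    ≡⟨ ∑-comm (λ x y → u x * (v y * h x y)) ⟩
  ∑[ y < k ] ∑[ x < m ] (u x * (v y * h x y))
    ≡⟨ sum-cong-≗ (λ y → sum-cong-≗ (λ x → x∙yz≈y∙xz (u x) (v y) (h x y))) ⟩
  ∑[ y < k ] ∑[ x < m ] (v y * (u x * h x y))
    ≡⟨ sum-cong-≗ (λ y → *-distribˡ-sum (v y) (λ x → u x * h x y)) ⟨
  ∑[ y < k ] (v y * ∑[ x < m ] (u x * h x y))  ∎
  where open ≡-Reasoning

∑-opposite : ∀ {m} (f : Fin m → ℕ) → ∑[ i < m ] f i ≡ ∑[ i < m ] f (opposite i)
∑-opposite f = ∑-permute f reverse

∑-δ : ∀ {B} (g : ℕ → ℕ) {t} → t < B → ∑[ s < B ] (g (toℕ s) * δ (toℕ s) t) ≡ g t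
∑-δ {suc B} g {t} t<B = subst (λ t → ∑[ s < suc B ] (g (toℕ s) * δ (toℕ s) t) ≡ g t)
                               (toℕ-fromℕ< t<B) (at (fromℕ< t<B))
  where
  open ≡-Reasoning
  at : (i : Fin (suc B)) → ∑[ s < suc B ] (g (toℕ s) * δ (toℕ s) (toℕ i)) ≡ g (toℕ i)
  at i = begin
    ∑[ s < suc B ] (g (toℕ s) * δ (toℕ s) (toℕ i))
      ≡⟨ sum-remove {i = i} (λ s → g (toℕ s) * δ (toℕ s) (toℕ i)) ⟩
    g (toℕ i) * δ (toℕ i) (toℕ i) + ∑[ j < B ] (g (toℕ (punchIn i j)) * δ (toℕ (punchIn i j)) (toℕ i))
      ≡⟨ cong₂ _+_ (cong (g (toℕ i) *_) (δ-≡ {toℕ i} refl))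
                   (sum-cong-≗ {B} (λ j → cong (g (toℕ (punchIn i j)) *_)
                                               (δ-≢ (punchInᵢ≢i i j ∘ toℕ-injective)))) ⟩
    g (toℕ i) * 1 + ∑[ j < B ] (g (toℕ (punchIn i j)) * 0)
      ≡⟨ cong₂ _+_ (*-identityʳ _)
                   (trans (sum-cong-≗ {B} (λ j → *-zeroʳ (g (toℕ (punchIn i j))))) (sum-replicate-zero B)) ⟩
    g (toℕ i) + 0
      ≡⟨ +-identityʳ _ ⟩
    g (toℕ i) ∎

2*m*n≤m*m+n*n : ∀ m n → 2 * (m * n) ≤ m * m + n * n
2*m*n≤m*m+n*n m n = [ ordered m n , (λ n≤m → subst₂ _≤_ (cong (2 *_) (*-comm n m)) (+-comm (n * n) (m * m))
                                                       (ordered n m n≤m)) ]′ (≤-total m n)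
  where
  square-gap : ∀ m o → 2 * (m * (m + o)) + o * o ≡ m * m + (m + o) * (m + o)
  square-gap = solve-∀
  ordered : ∀ m n → m ≤ n → 2 * (m * n) ≤ m * m + n * n
  ordered m n m≤n with o , refl ← m≤n⇒∃[o]m+o≡n m≤n = ≤-trans (m≤m+n _ (o * o)) (≤-reflexive (square-gap m o))

convex⇒inner≤outer : (u : ℕ → ℕ) (d : ℕ) →
  (∀ {i} → i ≤ d → 2 * u (suc i) ≤ u i + u (suc (suc i))) →
  u 1 + u (suc d) ≤ u 0 + u (suc (suc d))
convex⇒inner≤outer u zero    convex = ≤-trans (≤-reflexive (cong (u 1 +_) (sym (+-identityʳ _)))) (convex z≤n)
convex⇒inner≤outer u (suc d) convex = +-cancelʳ-≤ (u (suc d) + u (2 + d)) _ _ (begin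
  u 1 + u (2 + d) + (u (suc d) + u (2 + d))       ≡⟨ regroupˡ (u 1) (u (suc d)) (u (2 + d)) ⟩
  u 1 + u (suc d) + 2 * u (2 + d)                 ≤⟨ +-mono-≤ (convex⇒inner≤outer u d (convex ∘ m≤n⇒m≤1+n))
                                                               (convex ≤-refl) ⟩
  u 0 + u (2 + d) + (u (suc d) + u (3 + d))       ≡⟨ regroupʳ (u 0) (u (2 + d)) (u (suc d)) (u (3 + d)) ⟩
  u 0 + u (3 + d) + (u (suc d) + u (2 + d))       ∎)
  where
  open ≤-Reasoning
  regroupˡ : ∀ p q r → p + r + (q + r) ≡ p + q + 2 * r
  regroupˡ = solve-∀
  regroupʳ : ∀ p q r s → p + q + (r + s) ≡ p + s + (r + q)
  regroupʳ = solve-∀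

module Weighted (n : ℕ) where

  Weight : Set
  Weight = Fin n → ℕ

  _⊕_ : Weight → Weight → Weight
  (u ⊕ v) x = u x + v x

  wsum : List Weight → (ℕ → ℕ) → ℕ → ℕ
  wsum []      g a = g a
  wsum (w ∷ W) g a = ∑[ x < n ] (w x * wsum W g (a + val x))

  wsum-cong : ∀ W {g h} a → (∀ t → g t ≡ h t) → wsum W g a ≡ wsum W h a
  wsum-cong []      a g≗h = g≗h a
  wsum-cong (w ∷ W) a g≗h = sum-cong-≗ (λ x → cong (w x *_) (wsum-cong W (a + val x) g≗h))

  wsum-cong-≤ : ∀ W {g h} a → (∀ t → t ≤ a + length W * n → g t ≡ h t) → wsum W g a ≡ wsum W h a
  wsum-cong-≤ []      a g≗h = g≗h a (m≤m+n a 0)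
  wsum-cong-≤ (w ∷ W) a g≗h =
    sum-cong-≗ (λ x → cong (w x *_) (wsum-cong-≤ W (a + val x) (λ t t≤ → g≗h t (≤-trans t≤ (bound x)))))
    where
    bound : ∀ x → a + val x + length W * n ≤ a + (n + length W * n)
    bound x = ≤-trans (≤-reflexive (+-assoc a (val x) _)) (+-monoʳ-≤ a (+-monoˡ-≤ _ (toℕ<n x)))

  wsum-+ : ∀ W g h a → wsum W (λ t → g t + h t) a ≡ wsum W g a + wsum W h a
  wsum-+ []      g h a = refl
  wsum-+ (w ∷ W) g h a = trans
    (sum-cong-≗ (λ x → trans (cong (w x *_) (wsum-+ W g h (a + val x))) (*-distribˡ-+ (w x) _ _)))
    (∑-distrib-+ (λ x → w x * wsum W g (a + val x)) (λ x → w x * wsum W h (a + val x)))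

  wsum-* : ∀ W c g a → wsum W (λ t → c * g t) a ≡ c * wsum W g a
  wsum-* []      c g a = refl
  wsum-* (w ∷ W) c g a = trans
    (sum-cong-≗ (λ x → trans (cong (w x *_) (wsum-* W c g (a + val x))) (x∙yz≈y∙xz (w x) c _)))
    (sym (*-distribˡ-sum c (λ x → w x * wsum W g (a + val x))))

  wsum-∑ : ∀ W {m} (h : Fin m → ℕ → ℕ) a → wsum W (λ t → ∑[ s < m ] h s t) a ≡ ∑[ s < m ] wsum W (h s) a
  wsum-∑ []      h a = refl
  wsum-∑ (w ∷ W) h a = trans
    (sum-cong-≗ (λ x → trans (cong (w x *_) (wsum-∑ W h (a + val x)))
                             (*-distribˡ-sum (w x) (λ s → wsum W (h s) (a + val x)))))
    (∑-comm (λ x s → w x * wsum W (h s) (a + val x)))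

  wsum-shift : ∀ W g a b → wsum W g (a + b) ≡ wsum W (λ t → g (a + t)) b
  wsum-shift []      g a b = refl
  wsum-shift (w ∷ W) g a b = sum-cong-≗ (λ x → cong (w x *_)
    (trans (cong (wsum W g) (+-assoc a b (val x))) (wsum-shift W g a (b + val x))))

  wsum-from-0 : ∀ W g a → wsum W g a ≡ wsum W (λ t → g (a + t)) 0
  wsum-from-0 W g a = trans (cong (wsum W g) (sym (+-identityʳ a))) (wsum-shift W g a 0)

  wsum-⊕ : ∀ u v W g a → wsum ((u ⊕ v) ∷ W) g a ≡ wsum (u ∷ W) g a + wsum (v ∷ W) g a
  wsum-⊕ u v W g a = trans (sum-cong-≗ (λ x → *-distribʳ-+ _ (u x) (v x)))
                           (∑-distrib-+ (λ x → u x * wsum W g (a + val x)) (λ x → v x * wsum W g (a + val x)))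

  wsum-swap : ∀ u v W g a → wsum (u ∷ v ∷ W) g a ≡ wsum (v ∷ u ∷ W) g a
  wsum-swap u v W g a = trans (∑-*-comm u v (λ x y → wsum W g (a + val x + val y)))
    (sum-cong-≗ (λ y → cong (v y *_) (sum-cong-≗ (λ x →
      cong (λ b → u x * wsum W g b) (right-comm a (val x) (val y))))))
    where
    right-comm : ∀ p q r → p + q + r ≡ p + r + q
    right-comm = solve-∀

  wsum-↭ : ∀ {W W′} → W ↭ W′ → ∀ g a → wsum W g a ≡ wsum W′ g a
  wsum-↭ ↭.refl                  g a = refl
  wsum-↭ (↭.prep w p)            g a = sum-cong-≗ (λ x → cong (w x *_) (wsum-↭ p g (a + val x)))
  wsum-↭ (↭.swap {ys = W′} u v p) g a = trans
    (sum-cong-≗ (λ x → cong (u x *_) (sum-cong-≗ (λ y → cong (v y *_) (wsum-↭ p g _)))))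
    (wsum-swap u v W′ g a)
  wsum-↭ (↭.trans p q)           g a = trans (wsum-↭ p g a) (wsum-↭ q g a)

  wsum-expand : ∀ W B g → length W * n < B →
    wsum W g 0 ≡ ∑[ s < B ] (g (toℕ s) * wsum W (δ (toℕ s)) 0)
  wsum-expand W B g bound = begin
    wsum W g 0
      ≡⟨ wsum-cong-≤ W 0 (λ t t≤ → sym (∑-δ g (≤-<-trans t≤ bound))) ⟩
    wsum W (λ t → ∑[ s < B ] (g (toℕ s) * δ (toℕ s) t)) 0
      ≡⟨ wsum-∑ W (λ (s : Fin B) t → g (toℕ s) * δ (toℕ s) t) 0 ⟩
    ∑[ s < B ] wsum W (λ t → g (toℕ s) * δ (toℕ s) t) 0
      ≡⟨ sum-cong-≗ {B} (λ s → wsum-* W (g (toℕ s)) (δ (toℕ s)) 0) ⟩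
    ∑[ s < B ] (g (toℕ s) * wsum W (δ (toℕ s)) 0) ∎
    where open ≡-Reasoning

  -- coll P Q a c is the weighted number of pairs (x, y) ∈ [n]^|P| × [n]^|Q| with a + Σx = c + Σy.
  coll : List Weight → List Weight → ℕ → ℕ → ℕ
  coll P Q a c = wsum P (λ s → wsum Q (δ s) c) a

  energy : List Weight → ℕ
  energy W = coll W W 0 0

  coll-↭ : ∀ {P P′ Q Q′} → P ↭ P′ → Q ↭ Q′ → ∀ a c → coll P Q a c ≡ coll P′ Q′ a c
  coll-↭ {P′ = P′} P↭P′ Q↭Q′ a c = trans (wsum-↭ P↭P′ _ a) (wsum-cong P′ a (λ s → wsum-↭ Q↭Q′ (δ s) c))

  energy-↭ : ∀ {W W′} → W ↭ W′ → energy W ≡ energy W′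
  energy-↭ W↭W′ = coll-↭ W↭W′ W↭W′ 0 0

  coll-consʳ : ∀ P w Q a c → coll P (w ∷ Q) a c ≡ ∑[ y < n ] (w y * coll P Q a (c + val y))
  coll-consʳ P w Q a c = trans (wsum-∑ P (λ y s → w y * wsum Q (δ s) (c + val y)) a)
                               (sum-cong-≗ (λ y → wsum-* P (w y) (λ s → wsum Q (δ s) (c + val y)) a))

  coll-⊕ʳ : ∀ P u v Q a c → coll P ((u ⊕ v) ∷ Q) a c ≡ coll P (u ∷ Q) a c + coll P (v ∷ Q) a c
  coll-⊕ʳ P u v Q a c = trans (wsum-cong P a (λ s → wsum-⊕ u v Q (δ s) c))
                              (wsum-+ P (λ s → wsum (u ∷ Q) (δ s) c) (λ s → wsum (v ∷ Q) (δ s) c) a)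

  coll-shift : ∀ P Q {a c a′ c′} → a + c′ ≡ a′ + c → coll P Q a c ≡ coll P Q a′ c′
  coll-shift P Q {a} {c} {a′} {c′} balanced = begin
    coll P Q a c
      ≡⟨ centred a c ⟩
    wsum P (λ s → wsum Q (λ t → δ (a + s) (c + t)) 0) 0
      ≡⟨ wsum-cong P 0 (λ s → wsum-cong Q 0 (λ t →
           δ-cong (rebalance a c a′ c′ s t balanced) (rebalance a′ c′ a c s t (sym balanced)))) ⟩
    wsum P (λ s → wsum Q (λ t → δ (a′ + s) (c′ + t)) 0) 0
      ≡⟨ centred a′ c′ ⟨
    coll P Q a′ c′ ∎
    where
    open ≡-Reasoning
    centred : ∀ a c → coll P Q a c ≡ wsum P (λ s → wsum Q (λ t → δ (a + s) (c + t)) 0) 0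
    centred a c = trans (wsum-from-0 P _ a) (wsum-cong P 0 (λ s → wsum-from-0 Q (δ (a + s)) c))
    rearrange : ∀ p q r → p + q + r ≡ p + r + q
    rearrange = solve-∀
    rebalance : ∀ a c a′ c′ s t → a + c′ ≡ a′ + c → a + s ≡ c + t → a′ + s ≡ c′ + t
    rebalance a c a′ c′ s t balanced eq = +-cancelʳ-≡ c (a′ + s) (c′ + t) (begin
      a′ + s + c   ≡⟨ rearrange a′ s c ⟩
      a′ + c + s   ≡⟨ cong (_+ s) balanced ⟨
      a + c′ + s   ≡⟨ rearrange a c′ s ⟩
      a + s + c′   ≡⟨ cong (_+ c′) eq ⟩
      c + t + c′   ≡⟨ swap-outer c t c′ ⟩
      c′ + t + c   ∎)
      where
      swap-outer : ∀ p q r → p + q + r ≡ r + q + p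
      swap-outer = solve-∀

  -- The energy is Σ_s r(s)², r(s) = wsum W (δ s) 0, so this is 2 r_X r_Y ≤ r_X² + r_Y² summed over s.
  coll≤energy : ∀ X Y → 2 * coll X Y 0 0 ≤ energy X + energy Y
  coll≤energy X Y = begin
    2 * coll X Y 0 0                            ≡⟨ cong (2 *_) (wsum-expand X B (r Y) X<B) ⟩
    2 * ∑[ s < B ] (R Y s * R X s)              ≡⟨ *-distribˡ-sum 2 (λ s → R Y s * R X s) ⟩
    ∑[ s < B ] (2 * (R Y s * R X s))            ≤⟨ ∑-mono-≤ (λ s → 2*m*n≤m*m+n*n (R Y s) (R X s)) ⟩
    ∑[ s < B ] (R Y s * R Y s + R X s * R X s)  ≡⟨ ∑-distrib-+ (λ s → R Y s * R Y s) (λ s → R X s * R X s) ⟩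
    ∑[ s < B ] (R Y s * R Y s) + ∑[ s < B ] (R X s * R X s)
      ≡⟨ +-comm (∑[ s < B ] (R Y s * R Y s)) (∑[ s < B ] (R X s * R X s)) ⟩
    ∑[ s < B ] (R X s * R X s) + ∑[ s < B ] (R Y s * R Y s)
      ≡⟨ cong₂ _+_ (wsum-expand X B (r X) X<B) (wsum-expand Y B (r Y) Y<B) ⟨
    energy X + energy Y ∎
    where
    open ≤-Reasoning
    r : List Weight → ℕ → ℕ
    r Z s = wsum Z (δ s) 0
    B : ℕ
    B = suc (length X * n + length Y * n)
    R : List Weight → Fin B → ℕ
    R Z s = r Z (toℕ s)
    X<B : length X * n < B
    X<B = s≤s (m≤m+n _ _)
    Y<B : length Y * n < B
    Y<B = s≤s (m≤n+m _ _)

  energy-⊕ : ∀ u v W → energy ((u ⊕ v) ∷ W) ≤ 2 * (energy (u ∷ W) + energy (v ∷ W))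
  energy-⊕ u v W = begin
    energy ((u ⊕ v) ∷ W)
      ≡⟨ wsum-⊕ u v W (λ s → wsum ((u ⊕ v) ∷ W) (δ s) 0) 0 ⟩
    coll (u ∷ W) ((u ⊕ v) ∷ W) 0 0 + coll (v ∷ W) ((u ⊕ v) ∷ W) 0 0
      ≡⟨ cong₂ _+_ (coll-⊕ʳ (u ∷ W) u v W 0 0) (coll-⊕ʳ (v ∷ W) u v W 0 0) ⟩
    energy (u ∷ W) + coll (u ∷ W) (v ∷ W) 0 0 + (coll (v ∷ W) (u ∷ W) 0 0 + energy (v ∷ W))
      ≤⟨ cross-terms {energy (u ∷ W)} {energy (v ∷ W)}
                     (coll≤energy (u ∷ W) (v ∷ W)) (coll≤energy (v ∷ W) (u ∷ W)) ⟩
    2 * (energy (u ∷ W) + energy (v ∷ W)) ∎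
    where
    open ≤-Reasoning
    cross-terms : ∀ {p q r s} → 2 * r ≤ p + q → 2 * s ≤ q + p → p + r + (s + q) ≤ 2 * (p + q)
    cross-terms {p} {q} {r} {s} 2r≤ 2s≤ = *-cancelˡ-≤ 2 (begin
      2 * (p + r + (s + q))            ≡⟨ expand p q r s ⟩
      2 * (p + q) + (2 * r + 2 * s)    ≤⟨ +-monoʳ-≤ (2 * (p + q)) (+-mono-≤ 2r≤ 2s≤) ⟩
      2 * (p + q) + (p + q + (q + p))  ≡⟨ collect p q ⟩
      2 * (2 * (p + q))                ∎)
      where
      expand : ∀ p q r s → 2 * (p + r + (s + q)) ≡ 2 * (p + q) + (2 * r + 2 * s)
      expand = solve-∀
      collect : ∀ p q → 2 * (p + q) + (p + q + (q + p)) ≡ 2 * (2 * (p + q))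
      collect = solve-∀

  Σ⁴ : (A B C D : Weight) → (Fin n → Fin n → Fin n → Fin n → ℕ) → ℕ
  Σ⁴ A B C D k = ∑[ x < n ] (A x * ∑[ y < n ] (B y * ∑[ x′ < n ] (C x′ * ∑[ y′ < n ] (D y′ * k x y x′ y′))))

  Σ⁴-cong : ∀ A B C D {k l} → (∀ x y x′ y′ → k x y x′ y′ ≡ l x y x′ y′) → Σ⁴ A B C D k ≡ Σ⁴ A B C D l
  Σ⁴-cong A B C D k≗l = sum-cong-≗ (λ x → cong (A x *_) (sum-cong-≗ (λ y → cong (B y *_)
    (sum-cong-≗ (λ x′ → cong (C x′ *_) (sum-cong-≗ (λ y′ → cong (D y′ *_) (k≗l x y x′ y′))))))))

  Σ⁴-reflect : ∀ A B C D k →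
    Σ⁴ A B C D k ≡ Σ⁴ A (C ∘ opposite) D (B ∘ opposite) (λ x z′ y′ z → k x (opposite z) (opposite z′) y′)
  Σ⁴-reflect A B C D k = sum-cong-≗ (λ x → cong (A x *_) (begin
    ∑[ y < n ] (B y * ∑[ x′ < n ] (C x′ * inner x y x′))
      ≡⟨ ∑-opposite (λ y → B y * ∑[ x′ < n ] (C x′ * inner x y x′)) ⟩
    ∑[ z < n ] (B̄ z * ∑[ x′ < n ] (C x′ * inner x (opposite z) x′))
      ≡⟨ sum-cong-≗ (λ z → cong (B̄ z *_) (∑-opposite (λ x′ → C x′ * inner x (opposite z) x′))) ⟩
    ∑[ z < n ] (B̄ z * ∑[ z′ < n ] (C̄ z′ * inner x (opposite z) (opposite z′)))
      ≡⟨ ∑-*-comm B̄ C̄ (λ z z′ → inner x (opposite z) (opposite z′)) ⟩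
    ∑[ z′ < n ] (C̄ z′ * ∑[ z < n ] (B̄ z * inner x (opposite z) (opposite z′)))
      ≡⟨ sum-cong-≗ (λ z′ → cong (C̄ z′ *_) (∑-*-comm B̄ D (λ z y′ → k x (opposite z) (opposite z′) y′))) ⟩
    ∑[ z′ < n ] (C̄ z′ * ∑[ y′ < n ] (D y′ * ∑[ z < n ] (B̄ z * k x (opposite z) (opposite z′) y′))) ∎))
    where
    open ≡-Reasoning
    B̄ = B ∘ opposite
    C̄ = C ∘ opposite
    inner : Fin n → Fin n → Fin n → ℕ
    inner x y x′ = ∑[ y′ < n ] (D y′ * k x y x′ y′)

  coll-cons₂ : ∀ A B P C D Q a c →
    coll (A ∷ B ∷ P) (C ∷ D ∷ Q) a c ≡
    Σ⁴ A B C D (λ x y x′ y′ → coll P Q (a + val x + val y) (c + val x′ + val y′))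
  coll-cons₂ A B P C D Q a c = sum-cong-≗ (λ x → cong (A x *_) (sum-cong-≗ (λ y → cong (B y *_)
    (trans (coll-consʳ P C (D ∷ Q) (a + val x + val y) c)
           (sum-cong-≗ (λ x′ → cong (C x′ *_) (coll-consʳ P D Q (a + val x + val y) (c + val x′))))))))

  val-opposite : ∀ i → val (opposite i) + val i ≡ suc n
  val-opposite i = cong suc (trans (cong (_+ val i) (opposite-prop i)) (m∸n+n≡m (toℕ<n i)))

  -- Substituting y ↦ n+1-y and x′ ↦ n+1-x′ moves both variables across the equation
  -- x + y + Σp = x′ + y′ + Σq.
  coll-reflect : ∀ A B P C D Q →
    coll (A ∷ B ∷ P) (C ∷ D ∷ Q) 0 0 ≡ coll (A ∷ (C ∘ opposite) ∷ P) (D ∷ (B ∘ opposite) ∷ Q) 0 0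
  coll-reflect A B P C D Q = begin
    coll (A ∷ B ∷ P) (C ∷ D ∷ Q) 0 0
      ≡⟨ coll-cons₂ A B P C D Q 0 0 ⟩
    Σ⁴ A B C D (λ x y x′ y′ → coll P Q (val x + val y) (val x′ + val y′))
      ≡⟨ Σ⁴-reflect A B C D _ ⟩
    Σ⁴ A C̄ D B̄ (λ x z′ y′ z → coll P Q (val x + val (opposite z)) (val (opposite z′) + val y′))
      ≡⟨ Σ⁴-cong A C̄ D B̄ (λ x z′ y′ z → coll-shift P Q (balanced x y′ z z′)) ⟩
    Σ⁴ A C̄ D B̄ (λ x z′ y′ z → coll P Q (val x + val z′) (val y′ + val z))
      ≡⟨ coll-cons₂ A C̄ P D B̄ Q 0 0 ⟨
    coll (A ∷ C̄ ∷ P) (D ∷ B̄ ∷ Q) 0 0 ∎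
    where
    open ≡-Reasoning
    B̄ = B ∘ opposite
    C̄ = C ∘ opposite
    regroup₁ : ∀ p q r s → p + q + (r + s) ≡ p + r + (q + s)
    regroup₁ = solve-∀
    regroup₂ : ∀ p q r s → p + q + (r + s) ≡ p + s + (r + q)
    regroup₂ = solve-∀
    balanced : ∀ x y′ z z′ →
      val x + val (opposite z) + (val y′ + val z) ≡ val x + val z′ + (val (opposite z′) + val y′)
    balanced x y′ z z′ = begin
      val x + val (opposite z) + (val y′ + val z)
        ≡⟨ regroup₁ (val x) (val (opposite z)) (val y′) (val z) ⟩
      val x + val y′ + (val (opposite z) + val z)
        ≡⟨ cong (val x + val y′ +_) (trans (val-opposite z) (sym (val-opposite z′))) ⟩
      val x + val y′ + (val (opposite z′) + val z′)
        ≡⟨ regroup₂ (val x) (val y′) (val (opposite z′)) (val z′) ⟩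
      val x + val z′ + (val (opposite z′) + val y′) ∎

  energy-convex : ∀ u v V → 2 * energy (u ∷ v ∷ V) ≤ energy (u ∷ u ∷ V) + energy (v ∷ v ∷ V)
  energy-convex u v V = begin
    2 * energy (u ∷ v ∷ V)                   ≡⟨ cong (2 *_) (coll-reflect u v V u v V) ⟩
    2 * coll (u ∷ ū ∷ V) (v ∷ v̄ ∷ V) 0 0     ≤⟨ coll≤energy (u ∷ ū ∷ V) (v ∷ v̄ ∷ V) ⟩
    energy (u ∷ ū ∷ V) + energy (v ∷ v̄ ∷ V)  ≡⟨ cong₂ _+_ (coll-reflect u u V u u V)
                                                          (coll-reflect v v V v v V) ⟨
    energy (u ∷ u ∷ V) + energy (v ∷ v ∷ V)  ∎
    where
    open ≤-Reasoning
    ū = u ∘ opposite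
    v̄ = v ∘ opposite

  module _ (a b : Weight) where

    mixedEnergy : ℕ → List Weight → ℕ
    mixedEnergy zero    W = energy W
    mixedEnergy (suc k) W = mixedEnergy k (a ∷ W) + mixedEnergy k (b ∷ W)

    energy-⊕-replicate≤mixed : ∀ k W → energy (replicate k (a ⊕ b) ++ W) ≤ 2 ^ k * mixedEnergy k W
    energy-⊕-replicate≤mixed zero    W = ≤-reflexive (sym (*-identityˡ _))
    energy-⊕-replicate≤mixed (suc k) W = begin
      energy ((a ⊕ b) ∷ R ++ W)
        ≤⟨ energy-⊕ a b (R ++ W) ⟩
      2 * (energy (a ∷ R ++ W) + energy (b ∷ R ++ W))
        ≡⟨ cong (2 *_) (cong₂ _+_ (energy-↭ (↭-sym (shift a R W))) (energy-↭ (↭-sym (shift b R W)))) ⟩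
      2 * (energy (R ++ a ∷ W) + energy (R ++ b ∷ W))
        ≤⟨ *-monoʳ-≤ 2 (+-mono-≤ (energy-⊕-replicate≤mixed k (a ∷ W)) (energy-⊕-replicate≤mixed k (b ∷ W))) ⟩
      2 * (2 ^ k * mixedEnergy k (a ∷ W) + 2 ^ k * mixedEnergy k (b ∷ W))
        ≡⟨ cong (2 *_) (*-distribˡ-+ (2 ^ k) (mixedEnergy k (a ∷ W)) (mixedEnergy k (b ∷ W))) ⟨
      2 * (2 ^ k * mixedEnergy (suc k) W)
        ≡⟨ *-assoc 2 (2 ^ k) (mixedEnergy (suc k) W) ⟨
      2 ^ suc k * mixedEnergy (suc k) W ∎
      where
      open ≤-Reasoning
      R = replicate k (a ⊕ b)

    word : ℕ → ℕ → List Weight → List Weight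
    word i l W = replicate i a ++ replicate l b ++ W

    energy-word-convex : ∀ i l W →
      2 * energy (word (suc i) (suc l) W) ≤ energy (word i (suc (suc l)) W) + energy (word (suc (suc i)) l W)
    energy-word-convex i l W = begin
      2 * energy (word (suc i) (suc l) W)
        ≡⟨ cong (2 *_) (energy-↭ (↭.prep a (shift b A L))) ⟩
      2 * energy (a ∷ b ∷ A ++ L)
        ≤⟨ energy-convex a b (A ++ L) ⟩
      energy (a ∷ a ∷ A ++ L) + energy (b ∷ b ∷ A ++ L)
        ≡⟨ +-comm (energy (a ∷ a ∷ A ++ L)) (energy (b ∷ b ∷ A ++ L)) ⟩
      energy (b ∷ b ∷ A ++ L) + energy (a ∷ a ∷ A ++ L)
        ≡⟨ cong (_+ energy (a ∷ a ∷ A ++ L))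
                (energy-↭ (↭-sym (↭.trans (shift b A (b ∷ L)) (↭.prep b (shift b A L))))) ⟩
      energy (word i (suc (suc l)) W) + energy (word (suc (suc i)) l W) ∎
      where
      open ≤-Reasoning
      A = replicate i a
      L = replicate l b ++ W

    mixed≤pure-pair : ∀ j W →
      energy (replicate (suc j) b ++ a ∷ W) + energy (replicate (suc j) a ++ b ∷ W) ≤
      energy (replicate (suc (suc j)) a ++ W) + energy (replicate (suc (suc j)) b ++ W)
    mixed≤pure-pair j W = begin
      energy (replicate (suc j) b ++ a ∷ W) + energy (replicate (suc j) a ++ b ∷ W)
        ≡⟨ cong₂ _+_ (energy-↭ (shift a (replicate (suc j) b) W))
                     (cong (λ l → energy (word (suc j) l W)) (sym (m+n∸n≡m 1 j))) ⟩
      u 1 + u (suc j)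
        ≤⟨ convex⇒inner≤outer u j convex ⟩
      u 0 + u (suc (suc j))
        ≡⟨ +-comm (u 0) (u (suc (suc j))) ⟩
      u (suc (suc j)) + u 0
        ≡⟨ cong (λ l → energy (word (suc (suc j)) l W) + u 0) (n∸n≡0 j) ⟩
      energy (replicate (suc (suc j)) a ++ W) + energy (replicate (suc (suc j)) b ++ W) ∎
      where
      open ≤-Reasoning
      u : ℕ → ℕ
      u i = energy (word i (suc (suc j) ∸ i) W)
      convex : ∀ {i} → i ≤ j → 2 * u (suc i) ≤ u i + u (suc (suc i))
      convex {i} i≤j =
        subst₂ (λ l l′ → 2 * energy (word (suc i) l W) ≤ energy (word i l′ W) + u (suc (suc i)))
               (sym (+-∸-assoc 1 i≤j)) (sym (+-∸-assoc 2 i≤j)) (energy-word-convex i (j ∸ i) W)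

    mixed≤pure : ∀ j W → mixedEnergy (suc j) W ≤
      2 ^ j * (energy (replicate (suc j) a ++ W) + energy (replicate (suc j) b ++ W))
    mixed≤pure zero    W = ≤-reflexive (sym (*-identityˡ _))
    mixed≤pure (suc j) W = begin
      mixedEnergy (suc j) (a ∷ W) + mixedEnergy (suc j) (b ∷ W)
        ≤⟨ +-mono-≤ (mixed≤pure j (a ∷ W)) (mixed≤pure j (b ∷ W)) ⟩
      2 ^ j * (energy (aʲ ++ a ∷ W) + X) + 2 ^ j * (Y + energy (bʲ ++ b ∷ W))
        ≡⟨ cong₂ (λ p q → 2 ^ j * (p + X) + 2 ^ j * (Y + q))
                 (energy-↭ (shift a aʲ W)) (energy-↭ (shift b bʲ W)) ⟩
      2 ^ j * (A + X) + 2 ^ j * (Y + B)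
        ≡⟨ regroup (2 ^ j) A X Y B ⟩
      2 ^ j * ((X + Y) + (A + B))
        ≤⟨ *-monoʳ-≤ (2 ^ j) (+-monoˡ-≤ (A + B) (mixed≤pure-pair j W)) ⟩
      2 ^ j * ((A + B) + (A + B))
        ≡⟨ double (2 ^ j) (A + B) ⟩
      2 ^ suc j * (A + B) ∎
      where
      open ≤-Reasoning
      aʲ = replicate (suc j) a
      bʲ = replicate (suc j) b
      A = energy (replicate (suc (suc j)) a ++ W)
      B = energy (replicate (suc (suc j)) b ++ W)
      X = energy (bʲ ++ a ∷ W)
      Y = energy (aʲ ++ b ∷ W)
      regroup : ∀ t p x y q → t * (p + x) + t * (y + q) ≡ t * ((x + y) + (p + q))
      regroup = solve-∀
      double : ∀ t p → t * (p + p) ≡ 2 * t * p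
      double = solve-∀

    energy-⊕-replicate≤pure : ∀ m → 2 * energy (replicate (suc m) (a ⊕ b)) ≤
      2 ^ (suc m + suc m) * (energy (replicate (suc m) a) + energy (replicate (suc m) b))
    energy-⊕-replicate≤pure m = begin
      2 * energy (replicate k (a ⊕ b))
        ≡⟨ cong (λ W → 2 * energy W) (++-identityʳ (replicate k (a ⊕ b))) ⟨
      2 * energy (replicate k (a ⊕ b) ++ [])
        ≤⟨ *-monoʳ-≤ 2 (energy-⊕-replicate≤mixed k []) ⟩
      2 * (2 ^ k * mixedEnergy k [])
        ≤⟨ *-monoʳ-≤ 2 (*-monoʳ-≤ (2 ^ k) (mixed≤pure m [])) ⟩
      2 * (2 ^ k * (2 ^ m * (energy (replicate k a ++ []) + energy (replicate k b ++ []))))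
        ≡⟨ cong₂ (λ U V → 2 * (2 ^ k * (2 ^ m * (energy U + energy V))))
                 (++-identityʳ (replicate k a)) (++-identityʳ (replicate k b)) ⟩
      2 * (2 ^ k * (2 ^ m * pure))
        ≡⟨ regroup (2 ^ k) (2 ^ m) pure ⟩
      2 ^ k * 2 ^ k * pure
        ≡⟨ cong (_* pure) (^-distribˡ-+-* 2 k k) ⟨
      2 ^ (k + k) * pure ∎
      where
      open ≤-Reasoning
      k = suc m
      pure = energy (replicate k a) + energy (replicate k b)
      regroup : ∀ p q x → 2 * (p * (q * x)) ≡ p * (2 * q) * x
      regroup = solve-∀

  ∑ᵛ : ∀ j → (Vec (Fin n) j → ℕ) → ℕ
  ∑ᵛ zero    F = F []
  ∑ᵛ (suc j) F = ∑[ x < n ] ∑ᵛ j (λ y → F (x ∷ y))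

  ∑ᵛ-cong : ∀ j {F G} → (∀ y → F y ≡ G y) → ∑ᵛ j F ≡ ∑ᵛ j G
  ∑ᵛ-cong zero    F≗G = F≗G []
  ∑ᵛ-cong (suc j) F≗G = sum-cong-≗ (λ x → ∑ᵛ-cong j (λ y → F≗G (x ∷ y)))

  ∑ᵛ-+ : ∀ j F G → ∑ᵛ j (λ y → F y + G y) ≡ ∑ᵛ j F + ∑ᵛ j G
  ∑ᵛ-+ zero    F G = refl
  ∑ᵛ-+ (suc j) F G = trans (sum-cong-≗ (λ x → ∑ᵛ-+ j (λ y → F (x ∷ y)) (λ y → G (x ∷ y))))
                           (∑-distrib-+ (λ x → ∑ᵛ j (λ y → F (x ∷ y))) (λ x → ∑ᵛ j (λ y → G (x ∷ y))))

  ∑ᵛ-* : ∀ j c F → ∑ᵛ j (λ y → c * F y) ≡ c * ∑ᵛ j F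
  ∑ᵛ-* zero    c F = refl
  ∑ᵛ-* (suc j) c F = trans (sum-cong-≗ (λ x → ∑ᵛ-* j c (λ y → F (x ∷ y))))
                           (sym (*-distribˡ-sum c (λ x → ∑ᵛ j (λ y → F (x ∷ y)))))

  ∑ᵛ-splitAt : ∀ j k (G : Vec (Fin n) j → Vec (Fin n) k → ℕ) →
    ∑ᵛ (j + k) (λ x → G (take j x) (drop j x)) ≡ ∑ᵛ j (λ u → ∑ᵛ k (G u))
  ∑ᵛ-splitAt zero    k G = refl
  ∑ᵛ-splitAt (suc j) k G = sum-cong-≗ (λ x → ∑ᵛ-splitAt j k (λ u → G (x ∷ u)))

  sumˡ-allVecs : ∀ j F → sumˡ (map F (allVecs n j)) ≡ ∑ᵛ j F
  sumˡ-allVecs zero    F = +-identityʳ (F [])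
  sumˡ-allVecs (suc j) F = trans (sumˡ-concatMap-tabulate id (λ x → map (x ∷_) (allVecs n j)) F)
    (sum-cong-≗ (λ x → trans (cong sumˡ (sym (map-∘ (allVecs n j)))) (sumˡ-allVecs j (λ y → F (x ∷ y)))))

  length-filterᵇ-allVecs : ∀ j p → length (filterᵇ p (allVecs n j)) ≡ ∑ᵛ j (𝟙 ∘ p)
  length-filterᵇ-allVecs j p = trans (length-filterᵇ p (allVecs n j)) (sumˡ-allVecs j (𝟙 ∘ p))

  ∏ : ∀ {j} → Weight → Vec (Fin n) j → ℕ
  ∏ w []       = 1
  ∏ w (x ∷ xs) = w x * ∏ w xs

  ∏-splitAt : ∀ j {k} w (x : Vec (Fin n) (j + k)) → ∏ w x ≡ ∏ w (take j x) * ∏ w (drop j x)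
  ∏-splitAt zero    w x        = sym (*-identityˡ (∏ w x))
  ∏-splitAt (suc j) w (x ∷ xs) = trans (cong (w x *_) (∏-splitAt j w xs)) (sym (*-assoc (w x) _ _))

  ∏-1 : ∀ {j} w → (∀ x → w x ≡ 1) → (y : Vec (Fin n) j) → ∏ w y ≡ 1
  ∏-1 w w≡1 []      = refl
  ∏-1 w w≡1 (x ∷ y) = cong₂ _*_ (w≡1 x) (∏-1 w w≡1 y)

  ∑ᵛ-∏ : ∀ j w G c → ∑ᵛ j (λ y → ∏ w y * G (c + vsum y)) ≡ wsum (replicate j w) G c
  ∑ᵛ-∏ zero    w G c = trans (*-identityˡ _) (cong G (+-identityʳ c))
  ∑ᵛ-∏ (suc j) w G c = sum-cong-≗ (λ x → begin
    ∑ᵛ j (λ y → w x * ∏ w y * G (c + (val x + vsum y)))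
      ≡⟨ ∑ᵛ-cong j (λ y → trans (*-assoc (w x) (∏ w y) _)
                             (cong (λ t → w x * (∏ w y * G t)) (sym (+-assoc c (val x) (vsum y))))) ⟩
    ∑ᵛ j (λ y → w x * (∏ w y * G (c + val x + vsum y)))
      ≡⟨ ∑ᵛ-* j (w x) (λ y → ∏ w y * G (c + val x + vsum y)) ⟩
    w x * ∑ᵛ j (λ y → ∏ w y * G (c + val x + vsum y))
      ≡⟨ cong (w x *_) (∑ᵛ-∏ j w G (c + val x)) ⟩
    w x * wsum (replicate j w) G (c + val x) ∎)
    where open ≡-Reasoning

  ∑ᵛ-solutions : ∀ k w →
    ∑ᵛ (k + k) (λ x → ∏ w x * δ (vsum (take k x)) (vsum (drop k x))) ≡ energy (replicate k w)
  ∑ᵛ-solutions k w = begin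
    ∑ᵛ (k + k) (λ x → ∏ w x * δ (vsum (take k x)) (vsum (drop k x)))
      ≡⟨ ∑ᵛ-cong (k + k) (λ x → trans (cong (_* δ (vsum (take k x)) (vsum (drop k x))) (∏-splitAt k w x))
                                      (*-assoc (∏ w (take k x)) _ _)) ⟩
    ∑ᵛ (k + k) (λ x → G (take k x) (drop k x))
      ≡⟨ ∑ᵛ-splitAt k k G ⟩
    ∑ᵛ k (λ u → ∑ᵛ k (G u))
      ≡⟨ ∑ᵛ-cong k (λ u → trans (∑ᵛ-* k (∏ w u) (λ y → ∏ w y * δ (vsum u) (vsum y)))
                                (cong (∏ w u *_) (∑ᵛ-∏ k w (δ (vsum u)) 0))) ⟩
    ∑ᵛ k (λ u → ∏ w u * wsum (replicate k w) (δ (vsum u)) 0)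
      ≡⟨ ∑ᵛ-∏ k w (λ s → wsum (replicate k w) (δ s) 0) 0 ⟩
    energy (replicate k w) ∎
    where
    open ≡-Reasoning
    G : Vec (Fin n) k → Vec (Fin n) k → ℕ
    G u y = ∏ w u * (∏ w y * δ (vsum u) (vsum y))

module Colouring {n : ℕ} (f : Fin n → Bool) where

  open Weighted n

  colour : Bool → Weight
  colour c x = 𝟙 ⌊ f x ≟ᵇ c ⌋

  colour-partition : ∀ x → (colour true ⊕ colour false) x ≡ 1
  colour-partition x with f x
  ... | true  = refl
  ... | false = refl

  𝟙-vecAll : ∀ {j} (p : Fin n → Bool) (xs : Vec (Fin n) j) → 𝟙 (vecAll p xs) ≡ ∏ (𝟙 ∘ p) xs
  𝟙-vecAll p []       = refl
  𝟙-vecAll p (x ∷ xs) = trans (𝟙-∧ (p x) _) (cong (𝟙 (p x) *_) (𝟙-vecAll p xs))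

  ∏-colour : ∀ {j} c (xs : Vec (Fin n) j) →
    ∏ (colour c) xs ≡ 𝟙 ⌊ c ≟ᵇ true ⌋ * ∏ (colour true) xs + 𝟙 ⌊ c ≟ᵇ false ⌋ * ∏ (colour false) xs
  ∏-colour true  xs = sym (trans (+-identityʳ _) (*-identityˡ _))
  ∏-colour false xs = sym (*-identityˡ _)

  𝟙-isMono : ∀ {l} (x : Vec (Fin n) (suc l)) → 𝟙 (isMono f x) ≡ ∏ (colour true) x + ∏ (colour false) x
  𝟙-isMono (x₀ ∷ xs) = trans (𝟙-vecAll _ xs) (∏-colour (f x₀) xs)

  numSolutions≡energy : ∀ k → numSolutions n k ≡ energy (replicate k (colour true ⊕ colour false))
  numSolutions≡energy k = begin
    numSolutions n k
      ≡⟨ length-filterᵇ-allVecs (k + k) (isSolution k) ⟩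
    ∑ᵛ (k + k) (𝟙 ∘ isSolution k)
      ≡⟨ ∑ᵛ-cong (k + k) (λ x → sym (trans (cong (_* 𝟙 (isSolution k x)) (∏-1 _ colour-partition x))
                                           (*-identityˡ _))) ⟩
    ∑ᵛ (k + k) (λ x → ∏ (colour true ⊕ colour false) x * δ (vsum (take k x)) (vsum (drop k x)))
      ≡⟨ ∑ᵛ-solutions k (colour true ⊕ colour false) ⟩
    energy (replicate k (colour true ⊕ colour false)) ∎
    where open ≡-Reasoning

  numMonoSolutions≡energy : ∀ m → numMonoSolutions n (suc m) f ≡
    energy (replicate (suc m) (colour true)) + energy (replicate (suc m) (colour false))
  numMonoSolutions≡energy m = begin
    numMonoSolutions n k f
      ≡⟨ length-filterᵇ-allVecs (k + k) (λ x → isSolution k x ∧ isMono f x) ⟩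
    ∑ᵛ (k + k) (λ x → 𝟙 (isSolution k x ∧ isMono f x))
      ≡⟨ ∑ᵛ-cong (k + k) split ⟩
    ∑ᵛ (k + k) (λ x → mono true x + mono false x)
      ≡⟨ ∑ᵛ-+ (k + k) (mono true) (mono false) ⟩
    ∑ᵛ (k + k) (mono true) + ∑ᵛ (k + k) (mono false)
      ≡⟨ cong₂ _+_ (∑ᵛ-solutions k (colour true)) (∑ᵛ-solutions k (colour false)) ⟩
    energy (replicate k (colour true)) + energy (replicate k (colour false)) ∎
    where
    open ≡-Reasoning
    k = suc m
    mono : Bool → Vec (Fin n) (k + k) → ℕ
    mono c x = ∏ (colour c) x * δ (vsum (take k x)) (vsum (drop k x))
    split : ∀ x → 𝟙 (isSolution k x ∧ isMono f x) ≡ mono true x + mono false x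
    split x = begin
      𝟙 (isSolution k x ∧ isMono f x)
        ≡⟨ 𝟙-∧ (isSolution k x) (isMono f x) ⟩
      𝟙 (isSolution k x) * 𝟙 (isMono f x)
        ≡⟨ cong (𝟙 (isSolution k x) *_) (𝟙-isMono x) ⟩
      𝟙 (isSolution k x) * (∏ (colour true) x + ∏ (colour false) x)
        ≡⟨ *-comm (𝟙 (isSolution k x)) _ ⟩
      (∏ (colour true) x + ∏ (colour false) x) * 𝟙 (isSolution k x)
        ≡⟨ *-distribʳ-+ (𝟙 (isSolution k x)) (∏ (colour true) x) (∏ (colour false) x) ⟩
      mono true x + mono false x ∎

mainTheorem5 : (m n : ℕ) → (f : Fin n → Bool) →
    2 * numSolutions n (suc m) ≤ 2 ^ (suc m + suc m) * numMonoSolutions n (suc m) f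
mainTheorem5 m n f = begin
  2 * numSolutions n (suc m)
    ≡⟨ cong (2 *_) (numSolutions≡energy (suc m)) ⟩
  2 * energy (replicate (suc m) (colour true ⊕ colour false))
    ≤⟨ energy-⊕-replicate≤pure (colour true) (colour false) m ⟩
  2 ^ (suc m + suc m) * (energy (replicate (suc m) (colour true)) + energy (replicate (suc m) (colour false)))
    ≡⟨ cong (2 ^ (suc m + suc m) *_) (numMonoSolutions≡energy m) ⟨
  2 ^ (suc m + suc m) * numMonoSolutions n (suc m) f ∎
  where
  open ≤-Reasoning
  open Weighted n
  open Colouring f
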